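{- Let $n\geq1$, $m\geq2$ and let $\ell_a,\ell_b\geq0$ be integers with $\ell_a+\ell_b<m^n$. Then $q_{n,m}(\ell_a+\ell_b)$ equals either $q_{n,m}(\ell_a)+q_{n,m}(\ell_b)$ or $q_{n,m}(\ell_a)+q_{n,m}(\ell_b)-1$.
   Context: The corner vertices of the Sierpinski graph $S(n,m)$ (vertex set $\{0,\dots,m-1\}^n$) are $i^n=(i,\dots,i)$ for $0\leq i\leq m-1$. With $Lex(v)=1+\sum_{j=1}^n v_jm^{n-j}$, $q_{n,m}(\ell)$ is the number of corner vertices $v$ with $Lex(v)\leq\ell$. -}

module Defs where

open import Data.Nat using (ℕ; zero; suc; _+_; _*_; _^_; _≤?_)
open import Data.Fin using (Fin; toℕ; fromℕ)
open import Data.Fin.Base using (opposite)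
open import Data.List using (List; length; filter)
open import Data.List.Base using (allFin; map)
open import Data.Nat.ListAction using (sum)

-- A vertex of the Sierpinski graph S(n,m): a word v = (v_1,...,v_n) over {0,...,m-1},
-- represented as a function Fin n → Fin m (index 0 ↦ v_1).
Vertex : ℕ → ℕ → Set
Vertex n m = Fin n → Fin m

-- Lex(v) = 1 + Σ_{j=1}^n v_j m^{n-j}.  For index k : Fin n (k = j-1), the exponent
-- n - j = n - 1 - k is  toℕ (opposite k).
Lex : ∀ {n m} → Vertex n m → ℕ
Lex {n} {m} v = 1 + sum (map (λ k → toℕ (v k) * m ^ toℕ (opposite k)) (allFin n))

corner : ∀ {n m} → Fin m → Vertex n m
corner i = λ _ → i

q : ℕ → ℕ → ℕ → ℕ
q n m ℓ = length (filter (λ i → Lex {n} {m} (corner i) ≤? ℓ) (allFin m))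

module Submission where

open import Defs
open import Data.Nat using (ℕ; _+_; _∸_; _^_; _≤_; _<_)
open import Data.Sum using (_⊎_)
open import Relation.Binary.PropositionalEquality using (_≡_)

open import Data.Nat using (zero; suc; _*_; _≤?_; z≤n; s≤s; s≤s⁻¹)
open import Data.Nat.Properties
open import Data.Nat.ListAction using (sum)
open import Data.Nat.Tactic.RingSolver using (solve-∀)
open import Data.Fin using (Fin; toℕ)
import Data.Fin as Fin
open import Data.Fin.Base using (opposite)
open import Data.Fin.Properties using (toℕ-fromℕ)
open import Data.List using (List; []; _∷_; length; filter; map; allFin; tabulate)
open import Data.List.Properties using (filter-accept; filter-reject)
open import Data.Product using (_×_; _,_; ∃)
open import Data.Sum using (inj₁; inj₂)
open import Function using (_∘_; id; _⇔_; mk⇔; Equivalence)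
open import Relation.Nullary using (yes; no; contradiction)
open import Relation.Unary using (Pred; Decidable)
open import Relation.Binary.PropositionalEquality using (refl; sym; trans; cong; subst; module ≡-Reasoning)

-- The corner i^n has Lex = 1 + i·R with R = (11…1)_m, so q(ℓ) counts the i < m with
-- i·R < ℓ, which is ⌈ℓ/R⌉ as long as ℓ ≤ m·R.  The theorem is then the
-- subadditivity ⌈a/R⌉ + ⌈b/R⌉ - 1 ≤ ⌈(a+b)/R⌉ ≤ ⌈a/R⌉ + ⌈b/R⌉ of the ceiling.

length-filter-tabulate-threshold :
  ∀ {a p} {A : Set a} {P : Pred A p} (P? : Decidable P) {m K} (g : Fin m → A) →
  K ≤ m → (∀ i → P (g i) ⇔ toℕ i < K) → length (filter P? (tabulate g)) ≡ K
length-filter-tabulate-threshold P? {zero} g z≤n _ = refl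
length-filter-tabulate-threshold {P = P} P? {suc m} {zero} g z≤n P⇔ = begin
  length (filter P? (tabulate g))                  ≡⟨ cong length (filter-reject P? (λ p → n≮0 (to (P⇔ Fin.zero) p))) ⟩
  length (filter P? (tabulate (g ∘ Fin.suc)))      ≡⟨ length-filter-tabulate-threshold P? (g ∘ Fin.suc) z≤n P⇔′ ⟩
  0                                                ∎
  where
  open ≡-Reasoning
  open Equivalence
  P⇔′ : ∀ i → P (g (Fin.suc i)) ⇔ toℕ i < 0
  P⇔′ i = mk⇔ (λ p → contradiction (to (P⇔ (Fin.suc i)) p) n≮0) (λ ())
length-filter-tabulate-threshold {P = P} P? {suc m} {suc K} g (s≤s K≤m) P⇔ = begin
  length (filter P? (tabulate g))                  ≡⟨ cong length (filter-accept P? (from (P⇔ Fin.zero) (s≤s z≤n))) ⟩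
  suc (length (filter P? (tabulate (g ∘ Fin.suc)))) ≡⟨ cong suc (length-filter-tabulate-threshold P? (g ∘ Fin.suc) K≤m P⇔′) ⟩
  suc K                                            ∎
  where
  open ≡-Reasoning
  open Equivalence
  P⇔′ : ∀ i → P (g (Fin.suc i)) ⇔ toℕ i < K
  P⇔′ i = mk⇔ (λ p → s≤s⁻¹ (to (P⇔ (Fin.suc i)) p)) (λ i<K → from (P⇔ (Fin.suc i)) (s≤s i<K))

record CeilDiv (ℓ R K : ℕ) : Set where
  constructor ceilDiv
  field
    ≤*R : ℓ ≤ K * R
    *R< : K * R < ℓ + R

ceilDiv-exists : ∀ ℓ {R} → 0 < R → ∃ (CeilDiv ℓ R)
ceilDiv-exists zero    0<R = 0 , ceilDiv z≤n 0<R
ceilDiv-exists (suc ℓ) {R} 0<R with ceilDiv-exists ℓ 0<R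
... | K , ceilDiv ℓ≤KR KR<ℓ+R with suc ℓ ≤? K * R
...   | yes 1+ℓ≤KR = K , ceilDiv 1+ℓ≤KR (<-≤-trans KR<ℓ+R (+-monoˡ-≤ R (n≤1+n ℓ)))
...   | no  1+ℓ≰KR = suc K , ceilDiv 1+ℓ≤R+KR R+KR<1+ℓ+R
  where
  KR≡ℓ : K * R ≡ ℓ
  KR≡ℓ = ≤-antisym (s≤s⁻¹ (≰⇒> 1+ℓ≰KR)) ℓ≤KR
  1+ℓ≤R+KR : suc ℓ ≤ R + K * R
  1+ℓ≤R+KR = subst (λ x → suc ℓ ≤ R + x) (sym KR≡ℓ) (+-monoˡ-≤ ℓ 0<R)
  R+KR<1+ℓ+R : R + K * R < suc ℓ + R
  R+KR<1+ℓ+R = subst (_< suc ℓ + R) (trans (+-comm ℓ R) (cong (R +_) (sym KR≡ℓ)))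
                     (+-monoˡ-< R (n<1+n ℓ))

ceilDiv-<⇔ : ∀ {ℓ R K} i → CeilDiv ℓ R K → i * R < ℓ ⇔ i < K
ceilDiv-<⇔ {ℓ} {R} {K} i (ceilDiv ℓ≤KR KR<ℓ+R) = mk⇔
  (λ iR<ℓ → *-cancelʳ-< R i K (<-≤-trans iR<ℓ ℓ≤KR))
  (λ i<K → +-cancelˡ-< R (i * R) ℓ (begin-strict
    R + i * R  ≤⟨ *-monoˡ-≤ R i<K ⟩
    K * R      <⟨ KR<ℓ+R ⟩
    ℓ + R      ≡⟨ +-comm ℓ R ⟩
    R + ℓ      ∎))
  where open ≤-Reasoning

ceilDiv-≤ : ∀ {ℓ R K} m → CeilDiv ℓ R K → ℓ ≤ m * R → K ≤ m
ceilDiv-≤ {ℓ} {R} {K} m (ceilDiv _ KR<ℓ+R) ℓ≤mR = s≤s⁻¹ (*-cancelʳ-< R K (suc m) (begin-strict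
  K * R      <⟨ KR<ℓ+R ⟩
  ℓ + R      ≤⟨ +-monoˡ-≤ R ℓ≤mR ⟩
  m * R + R  ≡⟨ +-comm (m * R) R ⟩
  R + m * R  ∎))
  where open ≤-Reasoning

ceilDiv-+-bounds : ∀ {a b R Ka Kb K} →
                   CeilDiv a R Ka → CeilDiv b R Kb → CeilDiv (a + b) R K →
                   K ≤ Ka + Kb × Ka + Kb ≤ suc K
ceilDiv-+-bounds {a} {b} {R} {Ka} {Kb} {K}
  (ceilDiv a≤KaR KaR<a+R) (ceilDiv b≤KbR KbR<b+R) (ceilDiv a+b≤KR KR<a+b+R) =
  s≤s⁻¹ (*-cancelʳ-< R K (suc (Ka + Kb)) (begin-strict
    K * R                  <⟨ KR<a+b+R ⟩
    a + b + R              ≤⟨ +-monoˡ-≤ R (+-mono-≤ a≤KaR b≤KbR) ⟩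
    Ka * R + Kb * R + R    ≡⟨ x*r+y*r+r≡[1+x+y]*r Ka Kb R ⟩
    suc (Ka + Kb) * R      ∎)) ,
  s≤s⁻¹ (*-cancelʳ-< R (Ka + Kb) (suc (suc K)) (begin-strict
    (Ka + Kb) * R          ≡⟨ *-distribʳ-+ R Ka Kb ⟩
    Ka * R + Kb * R        <⟨ +-mono-< KaR<a+R KbR<b+R ⟩
    a + R + (b + R)        ≡⟨ x+r+[y+r]≡x+y+r+r a b R ⟩
    a + b + R + R          ≤⟨ +-monoˡ-≤ R (+-monoˡ-≤ R a+b≤KR) ⟩
    K * R + R + R          ≡⟨ x*r+r+r≡[2+x]*r K R ⟩
    suc (suc K) * R        ∎))
  where
  open ≤-Reasoning
  x*r+y*r+r≡[1+x+y]*r : ∀ x y r → x * r + y * r + r ≡ suc (x + y) * r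
  x*r+y*r+r≡[1+x+y]*r = solve-∀
  x+r+[y+r]≡x+y+r+r : ∀ x y r → x + r + (y + r) ≡ x + y + r + r
  x+r+[y+r]≡x+y+r+r = solve-∀
  x*r+r+r≡[2+x]*r : ∀ x r → x * r + r + r ≡ suc (suc x) * r
  x*r+r+r≡[2+x]*r = solve-∀

m≤n≤1+m⇒n≡m⊎n≡m+1 : ∀ {m n} → m ≤ n → n ≤ suc m → m ≡ n ⊎ m + 1 ≡ n
m≤n≤1+m⇒n≡m⊎n≡m+1 {m} m≤n n≤1+m with m≤n⇒m<n∨m≡n m≤n
... | inj₁ m<n = inj₂ (trans (+-comm m 1) (≤-antisym m<n n≤1+m))
... | inj₂ m≡n = inj₁ m≡n

repunit : ℕ → ℕ → ℕ
repunit n m = sum (map (λ k → m ^ toℕ (opposite k)) (allFin n))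

sum-map-*ˡ : ∀ {a} {A : Set a} c (f : A → ℕ) (xs : List A) →
             sum (map (λ x → c * f x) xs) ≡ c * sum (map f xs)
sum-map-*ˡ c f []       = sym (*-zeroʳ c)
sum-map-*ˡ c f (x ∷ xs) = trans (cong (c * f x +_) (sum-map-*ˡ c f xs)) (sym (*-distribˡ-+ c (f x) _))

Lex-corner : ∀ {n m} (i : Fin m) → Lex {n} (corner i) ≡ suc (toℕ i * repunit n m)
Lex-corner {n} {m} i = cong suc (sum-map-*ˡ (toℕ i) (λ k → m ^ toℕ (opposite k)) (allFin n))

q≡ceilDiv : ∀ n m {ℓ K} → ℓ ≤ m * repunit n m → CeilDiv ℓ (repunit n m) K → q n m ℓ ≡ K
q≡ceilDiv n m {ℓ} {K} ℓ≤mR ℓ/R =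
  length-filter-tabulate-threshold (λ i → Lex {n} (corner i) ≤? ℓ) id (ceilDiv-≤ m ℓ/R ℓ≤mR) Lex≤ℓ⇔
  where
  open Equivalence
  Lex≤ℓ⇔ : ∀ (i : Fin m) → Lex {n} (corner i) ≤ ℓ ⇔ toℕ i < K
  Lex≤ℓ⇔ i = mk⇔ (λ p → to (ceilDiv-<⇔ (toℕ i) ℓ/R) (subst (_≤ ℓ) (Lex-corner {n} i) p))
                 (λ p → subst (_≤ ℓ) (sym (Lex-corner {n} i)) (from (ceilDiv-<⇔ (toℕ i) ℓ/R) p))

m^n≤repunit[1+n] : ∀ n m → m ^ n ≤ repunit (suc n) m
m^n≤repunit[1+n] n m = subst (λ e → m ^ e ≤ repunit (suc n) m) (toℕ-fromℕ n) (m≤m+n _ _)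

q-+ : ∀ n m ℓa ℓb → 0 < repunit n m → ℓa + ℓb ≤ m * repunit n m →
      (q n m (ℓa + ℓb) ≡ q n m ℓa + q n m ℓb) ⊎ (q n m (ℓa + ℓb) + 1 ≡ q n m ℓa + q n m ℓb)
q-+ n m ℓa ℓb 0<R ℓa+ℓb≤mR
  with ceilDiv-exists ℓa 0<R | ceilDiv-exists ℓb 0<R | ceilDiv-exists (ℓa + ℓb) 0<R
... | Ka , ℓa/R | Kb , ℓb/R | K , ℓ/R
  rewrite q≡ceilDiv n m (≤-trans (m≤m+n ℓa ℓb) ℓa+ℓb≤mR) ℓa/R
        | q≡ceilDiv n m (≤-trans (m≤n+m ℓb ℓa) ℓa+ℓb≤mR) ℓb/R
        | q≡ceilDiv n m ℓa+ℓb≤mR ℓ/R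
  with K≤Ka+Kb , Ka+Kb≤1+K ← ceilDiv-+-bounds ℓa/R ℓb/R ℓ/R
  = m≤n≤1+m⇒n≡m⊎n≡m+1 K≤Ka+Kb Ka+Kb≤1+K

lemma7 : (n m ℓa ℓb : ℕ) → 1 ≤ n → 2 ≤ m → ℓa + ℓb < m ^ n →
           (q n m (ℓa + ℓb) ≡ q n m ℓa + q n m ℓb)
           ⊎ (q n m (ℓa + ℓb) + 1 ≡ q n m ℓa + q n m ℓb)
lemma7 zero _ _ _ () _ _
lemma7 (suc n) zero _ _ _ () _
lemma7 (suc n) m@(suc _) ℓa ℓb _ _ ℓa+ℓb<m^n = q-+ (suc n) m ℓa ℓb 0<R ℓa+ℓb≤mR
  where
  0<R : 0 < repunit (suc n) m
  0<R = <-≤-trans (m^n>0 m n) (m^n≤repunit[1+n] n m)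
  ℓa+ℓb≤mR : ℓa + ℓb ≤ m * repunit (suc n) m
  ℓa+ℓb≤mR = ≤-trans (<⇒≤ ℓa+ℓb<m^n) (*-monoʳ-≤ m (m^n≤repunit[1+n] n m))
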